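{- Define a sequence of integer vectors $\beta^{(r)}=(\beta^{(r)}_1,\dots,\beta^{(r)}_r)$ of length $r$ for $r\ge 2$ by $\beta^{(2)}=(3,2)$ and, for $r>2$, \[\beta_i^{(r)}=\begin{cases}2(\beta_i^{(r-1)}+r-2) & i<r,\\ 2r-3 & i=r.\end{cases}\] If $r\ge 2$ and $D$ is a finite digraph containing no $(r-1)$-source sets, then $D$ contains a $\beta^{(r)}$-kernel.
   Context: For $S\subseteq V(D)$, $N^-(S)=\{u\in V(D)\setminus S:\exists v\in S,\ uv\in E(D)\}$. $S$ is a source set if $N^-(S)=\emptyset$; it is an $s$-source set if additionally $S\neq\emptyset$ and $|S|\le s$. A set is independent if there are no arcs between two of its vertices. $\mathrm{dist}(S,v)$ is the minimum over $u\in S$ of the length of a shortest directed path from $u$ to $v$. A $q$-kernel is an independent set $Q$ with $\mathrm{dist}(Q,v)\le q$ for all $v$. Given a vector $\beta$ of length $r$, a $\beta$-kernel of $D$ is a tuple $(Q_1,\dots,Q_r)$ of pairwise disjoint vertex subsets such that each $Q_i$ is a $\beta_i$-kernel of $D$. -}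

module Defs where

open import Data.Nat using (ℕ; zero; suc; _+_; _*_; _≤_)
open import Data.Bool using (Bool; true; false)
open import Data.Fin using (Fin)
open import Data.Fin.Subset using (Subset; _∈_; _∉_; ∣_∣; Nonempty)
open import Data.Vec using (Vec; []; _∷_; map; _∷ʳ_; lookup)
open import Data.Product using (Σ; _×_; ∃)
open import Relation.Nullary using (¬_)
open import Relation.Binary.PropositionalEquality using (_≡_; _≢_)
open import Data.Empty using (⊥)

record Digraph (n : ℕ) : Set where
  field
    arc     : Fin n → Fin n → Bool
    noLoops : ∀ v → arc v v ≡ false
open Digraph public

Arc : ∀ {n} → Digraph n → Fin n → Fin n → Set
Arc D u v = arc D u v ≡ true

IsSourceSet : ∀ {n} → Digraph n → Subset n → Set
IsSourceSet D S = ∀ u v → v ∈ S → u ∉ S → ¬ Arc D u v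

IsSSourceSet : ∀ {n} → Digraph n → ℕ → Subset n → Set
IsSSourceSet D s S = IsSourceSet D S × Nonempty S × ∣ S ∣ ≤ s

Independent : ∀ {n} → Digraph n → Subset n → Set
Independent D Q = ∀ u v → u ∈ Q → v ∈ Q → ¬ Arc D u v

-- Walk D k u v : there is a directed walk from u to v of length at most k.
-- (Equivalently, the shortest directed path from u to v has length ≤ k.)
data Walk {n} (D : Digraph n) : ℕ → Fin n → Fin n → Set where
  here : ∀ {k u} → Walk D k u u
  step : ∀ {k u w v} → Arc D u w → Walk D k w v → Walk D (suc k) u v

DistLe : ∀ {n} → Digraph n → Subset n → Fin n → ℕ → Set
DistLe D S v q = Σ _ λ u → u ∈ S × Walk D q u v

IsQKernel : ∀ {n} → Digraph n → ℕ → Subset n → Set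
IsQKernel D q Q = Independent D Q × (∀ v → DistLe D Q v q)

IsBetaKernel : ∀ {n r} → Digraph n → Vec ℕ r → (Fin r → Subset n) → Set
IsBetaKernel D β Q =
  (∀ i j → i ≢ j → ∀ v → v ∈ Q i → v ∉ Q j) ×
  (∀ i → IsQKernel D (lookup β i) (Q i))

-- β^{(k+2)} : β^{(2)} = (3,2);  for r = k+3 > 2,
-- β_i^{(r)} = 2(β_i^{(r-1)} + r - 2) for i < r, β_r^{(r)} = 2r - 3.
betaVec : (k : ℕ) → Vec ℕ (suc (suc k))
betaVec zero = 3 ∷ 2 ∷ []
betaVec (suc k) = map (λ b → 2 * (b + suc k)) (betaVec k) ∷ʳ (2 * k + 3)

module Submission where

-- Induction on r, proving the statement for an arbitrary vertex set U in place of V(D),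
-- with all walks running inside U. A Chvátal–Lovász quasi-kernel Q₀ of U for walks of
-- length ≤ r - 2 (independence) and ≤ r - 1 (absorption) is independent and reaches U
-- within 2r - 3. The square of D through U, restricted to U ∖ Q₀, has no (r - 2)-source
-- sets, so by induction it has a β^(r-1)-kernel. Its walks double in length in D, and a
-- vertex of Q₀ is reached one step later through an in-neighbour outside Q₀, so its
-- layers reach U within 2β_i^(r-1) + 1 ≤ β_i^(r), while Q₀ becomes the last layer.
-- For r = 2 two quasi-kernels for single arcs give layers reaching U within 3 and 2.

open import Defs
open import Data.Nat using (ℕ; zero; suc; _+_; _*_; _≤_; _<_; z≤n; s≤s; _≤?_)
open import Data.Nat.Properties
  using ( ≤-refl; ≤-trans; ≤-reflexive; n≤1+n; m≤m+n; m≤n+m; *-suc; <-irrefl; ≰⇒>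
        ; module ≤-Reasoning)
open import Data.Nat.Solver using (module +-*-Solver)
open import Data.Bool using (true)
open import Data.Bool.Properties using () renaming (_≟_ to _≟ᵇ_)
open import Data.Empty using (⊥; ⊥-elim)
open import Data.Fin using (Fin; zero; suc; inject₁; fromℕ; _≟_)
open import Data.Fin.Properties using (any?)
open import Data.Fin.Subset
  using (Subset; _∈_; _∉_; _⊆_; ∣_∣; Nonempty; ⊤; ⁅_⁆; _∪_; _─_; inside; outside)
  renaming (⊥ to ∅)
open import Data.Fin.Subset.Properties
  using ( _∈?_; ∈⊤; ∉⊥; x∈⁅x⁆; x∈⁅y⁆⇒x≡y; ∣⁅x⁆∣≡1; x∈p∪q⁺; x∈p∪q⁻
        ; x∈p∧x∉q⇒x∈p─q; p─q⊆p; ∪-identityʳ; p⊆q⇒∣p∣≤∣q∣; p⊂q⇒∣p∣<∣q∣)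
open import Data.Vec using (Vec; []; _∷_; lookup; tabulate; map; _∷ʳ_; here; there)
open import Data.Vec.Properties using (lookup∘tabulate; lookup-map; []=⇒lookup; lookup⇒[]=)
open import Data.List using (List; []; _∷_; allFin)
open import Data.List.Relation.Unary.Any using (here; there)
open import Data.List.Membership.Propositional using () renaming (_∈_ to _∈ₗ_)
open import Data.List.Membership.Propositional.Properties using (∈-allFin)
open import Data.Product using (Σ; ∃; ∃₂; _×_; _,_; proj₁; proj₂)
open import Data.Sum using (_⊎_; inj₁; inj₂)
open import Function using (_∘_; id; case_of_)
open import Relation.Nullary using (¬_; Dec; yes; no; does)
open import Relation.Nullary.Decidable using (dec-true; dec-false; _×-dec_; _⊎-dec_; ¬?)
open import Relation.Binary.PropositionalEquality
  using (_≡_; _≢_; refl; sym; trans; cong; subst)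

private
  variable
    n r : ℕ

does-true : ∀ {A : Set} (a? : Dec A) → does a? ≡ true → A
does-true (yes a) _ = a

⟦_⟧ : {P : Fin n → Set} → (∀ x → Dec (P x)) → Subset n
⟦ P? ⟧ = tabulate (does ∘ P?)

∈⟦⟧⁺ : {P : Fin n → Set} (P? : ∀ x → Dec (P x)) → ∀ {x} → P x → x ∈ ⟦ P? ⟧
∈⟦⟧⁺ P? {x} p = lookup⇒[]= x _ (trans (lookup∘tabulate _ x) (dec-true (P? x) p))

∈⟦⟧⁻ : {P : Fin n → Set} (P? : ∀ x → Dec (P x)) → ∀ {x} → x ∈ ⟦ P? ⟧ → P x
∈⟦⟧⁻ P? {x} x∈ = does-true (P? x) (trans (sym (lookup∘tabulate _ x)) ([]=⇒lookup x∈))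

⁅x⁆⊆p : ∀ {x} {p : Subset n} → x ∈ p → ⁅ x ⁆ ⊆ p
⁅x⁆⊆p {x = x} {p} x∈p y∈⁅x⁆ = subst (_∈ p) (sym (x∈⁅y⁆⇒x≡y x y∈⁅x⁆)) x∈p

x∈p─q⇒x∉q : (p q : Subset n) → ∀ {x} → x ∈ p ─ q → x ∉ q
x∈p─q⇒x∉q (_ ∷ p) (_ ∷ q) (there x∈p─q) (there x∈q) = x∈p─q⇒x∉q p q x∈p─q x∈q
x∈p─q⇒x∉q (_ ∷ p) (inside ∷ q) () here

∣p∪⁅x⁆∣≤1+∣p∣ : (p : Subset n) (x : Fin n) → ∣ p ∪ ⁅ x ⁆ ∣ ≤ suc ∣ p ∣
∣p∪⁅x⁆∣≤1+∣p∣ (outside ∷ p) zero rewrite ∪-identityʳ p = ≤-refl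
∣p∪⁅x⁆∣≤1+∣p∣ (inside ∷ p) zero rewrite ∪-identityʳ p = n≤1+n _
∣p∪⁅x⁆∣≤1+∣p∣ (outside ∷ p) (suc x) = ∣p∪⁅x⁆∣≤1+∣p∣ p x
∣p∪⁅x⁆∣≤1+∣p∣ (inside ∷ p) (suc x) = s≤s (∣p∪⁅x⁆∣≤1+∣p∣ p x)

data InjectOrLast : Fin (suc r) → Set where
  inject : (j : Fin r) → InjectOrLast (inject₁ j)
  last   : InjectOrLast (fromℕ r)

injectOrLast : (i : Fin (suc r)) → InjectOrLast i
injectOrLast {zero} zero = last
injectOrLast {suc r} zero = inject zero
injectOrLast {suc r} (suc i) with injectOrLast i
... | inject j = inject (suc j)
... | last = last

lookup-∷ʳ-inject₁ : ∀ {A : Set} (xs : Vec A r) x j →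
                    lookup (xs ∷ʳ x) (inject₁ j) ≡ lookup xs j
lookup-∷ʳ-inject₁ (_ ∷ _) x zero = refl
lookup-∷ʳ-inject₁ (_ ∷ xs) x (suc j) = lookup-∷ʳ-inject₁ xs x j

lookup-∷ʳ-last : ∀ {A : Set} (xs : Vec A r) x → lookup (xs ∷ʳ x) (fromℕ r) ≡ x
lookup-∷ʳ-last [] x = refl
lookup-∷ʳ-last (_ ∷ xs) x = lookup-∷ʳ-last xs x

arc? : (D : Digraph n) → ∀ u v → Dec (Arc D u v)
arc? D u v = arc D u v ≟ᵇ true

arc⇒≢ : (D : Digraph n) → ∀ {u v} → Arc D u v → u ≢ v
arc⇒≢ D {u} u→u refl with trans (sym u→u) (noLoops D u)
... | ()

data WalkIn (D : Digraph n) (U : Subset n) : ℕ → Fin n → Fin n → Set where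
  nil  : ∀ {m u} → WalkIn D U m u u
  cons : ∀ {m u w v} → u ∈ U → Arc D u w → WalkIn D U m w v → WalkIn D U (suc m) u v

module _ {D : Digraph n} {U : Subset n} where

  weaken-walk : ∀ {m m′ u v} → m ≤ m′ → WalkIn D U m u v → WalkIn D U m′ u v
  weaken-walk _ nil = nil
  weaken-walk (s≤s m≤m′) (cons u∈U u→w w⇝v) = cons u∈U u→w (weaken-walk m≤m′ w⇝v)

  _++ʷ_ : ∀ {m m′ u v w} → WalkIn D U m u v → WalkIn D U m′ v w → WalkIn D U (m + m′) u w
  _++ʷ_ {m} {m′} nil v⇝w = weaken-walk (m≤n+m m′ m) v⇝w
  cons u∈U u→x x⇝v ++ʷ v⇝w = cons u∈U u→x (x⇝v ++ʷ v⇝w)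

  _∷ʳʷ_ : ∀ {m u v w} → WalkIn D U m u v → v ∈ U × Arc D v w → WalkIn D U (suc m) u w
  nil ∷ʳʷ (v∈U , v→w) = cons v∈U v→w nil
  cons u∈U u→x x⇝v ∷ʳʷ v→w = cons u∈U u→x (x⇝v ∷ʳʷ v→w)

  WalkIn⇒Walk : ∀ {m u v} → WalkIn D U m u v → Walk D m u v
  WalkIn⇒Walk nil = here
  WalkIn⇒Walk (cons _ u→w w⇝v) = step u→w (WalkIn⇒Walk w⇝v)

  walk? : ∀ m u v → Dec (WalkIn D U m u v)
  walk? m u v with u ≟ v
  walk? m u .u | yes refl = yes nil
  walk? zero u v | no u≢v = no λ { nil → u≢v refl }
  walk? (suc m) u v | no u≢v with (u ∈? U) ×-dec any? (λ w → arc? D u w ×-dec walk? m w v)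
  ... | yes (u∈U , w , u→w , w⇝v) = yes (cons u∈U u→w w⇝v)
  ... | no ¬step = no λ { nil → u≢v refl
                         ; (cons u∈U u→w w⇝v) → ¬step (u∈U , _ , u→w , w⇝v) }

Dominates : (D : Digraph n) (U : Subset n) → ℕ → Subset n → Subset n → Set
Dominates D U d Q W = ∀ {v} → v ∈ W → ∃ λ q → q ∈ Q × WalkIn D U d q v

weaken-dominates : ∀ {D : Digraph n} {U Q W d d′} →
                   d ≤ d′ → Dominates D U d Q W → Dominates D U d′ Q W
weaken-dominates d≤d′ dom v∈W =
  let (q , q∈Q , q⇝v) = dom v∈W in q , q∈Q , weaken-walk d≤d′ q⇝v

IsSourceSetIn : Digraph n → Subset n → Subset n → Set
IsSourceSetIn D U S = ∀ u v → v ∈ S → u ∈ U → u ∉ S → ¬ Arc D u v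

NoSSourceSetIn : Digraph n → Subset n → ℕ → Set
NoSSourceSetIn D U s = ∀ {S} → S ⊆ U → IsSourceSetIn D U S → Nonempty S → ∣ S ∣ ≤ s → ⊥

module _ {D : Digraph n} {U : Subset n} where

  enteringArc : ∀ {s S} → NoSSourceSetIn D U s → S ⊆ U → Nonempty S → ∣ S ∣ ≤ s →
                ∃₂ λ u v → u ∈ U × u ∉ S × v ∈ S × Arc D u v
  enteringArc {S = S} noSource S⊆U nonempty ∣S∣≤s
    with any? (λ u → any? (λ v → (u ∈? U) ×-dec ¬? (u ∈? S) ×-dec (v ∈? S) ×-dec arc? D u v))
  ... | yes (u , v , entering) = u , v , entering
  ... | no none = ⊥-elim (noSource S⊆U source nonempty ∣S∣≤s)
    where
    source : IsSourceSetIn D U S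
    source u v v∈S u∈U u∉S u→v = none (u , v , u∈U , u∉S , v∈S , u→v)

  inNeighbour : ∀ {s} → NoSSourceSetIn D U (suc s) →
                ∀ {v} → v ∈ U → ∃ λ u → u ∈ U × Arc D u v
  inNeighbour noSource {v} v∈U =
    let (u , a , u∈U , _ , a∈⁅v⁆ , u→a) =
          enteringArc noSource (⁅x⁆⊆p v∈U) (v , x∈⁅x⁆ v)
                      (subst (_≤ suc _) (sym (∣⁅x⁆∣≡1 v)) (s≤s z≤n))
    in u , u∈U , subst (Arc D u) (x∈⁅y⁆⇒x≡y v a∈⁅v⁆) u→a

  InBall : ℕ → Fin n → Fin n → Set
  InBall j v a = a ∈ U × WalkIn D U j a v

  inBall? : ∀ j v a → Dec (InBall j v a)
  inBall? j v a = (a ∈? U) ×-dec walk? j a v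

  ball : ℕ → Fin n → Subset n
  ball j v = ⟦ inBall? j v ⟧

  ball-mono : ∀ {j v} → ball j v ⊆ ball (suc j) v
  ball-mono {j} {v} a∈ = let (a∈U , a⇝v) = ∈⟦⟧⁻ (inBall? j v) a∈ in
    ∈⟦⟧⁺ (inBall? (suc j) v) (a∈U , weaken-walk (n≤1+n j) a⇝v)

  radius<∣ball∣ : ∀ {s} → NoSSourceSetIn D U s →
                  ∀ {v} → v ∈ U → ∀ j → j ≤ s → j < ∣ ball j v ∣
  radius<∣ball∣ noSource {v} v∈U zero _ =
    subst (_≤ ∣ ball zero v ∣) (∣⁅x⁆∣≡1 v) (p⊆q⇒∣p∣≤∣q∣ (⁅x⁆⊆p (∈⟦⟧⁺ (inBall? 0 v) (v∈U , nil))))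
  radius<∣ball∣ {s} noSource {v} v∈U (suc j) 1+j≤s
    with radius<∣ball∣ noSource v∈U j (≤-trans (n≤1+n j) 1+j≤s) | ∣ ball j v ∣ ≤? s
  ... | _ | no ∣ball∣≰s =
    ≤-trans (s≤s 1+j≤s) (≤-trans (≰⇒> ∣ball∣≰s) (p⊆q⇒∣p∣≤∣q∣ ball-mono))
  ... | j<∣ball∣ | yes ∣ball∣≤s =
    let (u , a , u∈U , u∉ball , a∈ball , u→a) =
          enteringArc noSource (proj₁ ∘ ∈⟦⟧⁻ (inBall? j v)) (v , ∈⟦⟧⁺ (inBall? j v) (v∈U , nil))
                      ∣ball∣≤s
        u⇝v = cons u∈U u→a (proj₂ (∈⟦⟧⁻ (inBall? j v) a∈ball))
        u∈ball′ = ∈⟦⟧⁺ (inBall? (suc j) v) (u∈U , u⇝v)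
    in ≤-trans (s≤s j<∣ball∣) (p⊂q⇒∣p∣<∣q∣ (ball-mono , u , u∈ball′ , u∉ball))

-- Quasi-kernels for a pair of relations B ⊆ A

Independentᴿ : (Fin n → Fin n → Set) → Subset n → Set
Independentᴿ R Q = ∀ {q q′} → q ∈ Q → q′ ∈ Q → R q q′ → q ≡ q′

HasMinimal : (Fin n → Fin n → Set) → Subset n → Set
HasMinimal {n} R Q = ∀ (X : Subset n) → (∃ λ x → x ∈ X × x ∈ Q) →
  ∃ λ q → q ∈ X × q ∈ Q × (∀ {q′} → q′ ∈ X → q′ ∈ Q → R q′ q → q′ ≡ q)

record QuasiKernel (A B : Fin n → Fin n → Set) (W : Subset n) : Set where
  field
    kernel      : Subset n
    kernel⊆W    : kernel ⊆ W
    independent : Independentᴿ B kernel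
    absorbing   : ∀ {w} → w ∈ W → ∃ λ q → q ∈ kernel × ∃ λ x → B q x × A x w
    minimal     : HasMinimal A kernel

-- Chvátal–Lovász: process the vertices one by one; a vertex v of W either is
-- B-reached from the kernel built on W minus the A-successors of v, or joins it.
module QuasiKernelConstruction {A B : Fin n → Fin n → Set}
  (A? : ∀ u v → Dec (A u v)) (B? : ∀ u v → Dec (B u v))
  (B-refl : ∀ v → B v v) (B⇒A : ∀ {u v} → B u v → A u v) where

  open QuasiKernel

  insert-independent : ∀ {K v} → Independentᴿ B K →
    (∀ {x} → x ∈ K → ¬ A v x) → (∀ {x} → x ∈ K → ¬ B x v) → Independentᴿ B (⁅ v ⁆ ∪ K)
  insert-independent {K} {v} K-independent v↛K K↛v q∈ q′∈ q→q′
    with x∈p∪q⁻ ⁅ v ⁆ K q∈ | x∈p∪q⁻ ⁅ v ⁆ K q′∈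
  ... | inj₁ q∈⁅v⁆ | inj₁ q′∈⁅v⁆ = trans (x∈⁅y⁆⇒x≡y v q∈⁅v⁆) (sym (x∈⁅y⁆⇒x≡y v q′∈⁅v⁆))
  ... | inj₁ q∈⁅v⁆ | inj₂ q′∈K rewrite x∈⁅y⁆⇒x≡y v q∈⁅v⁆ = ⊥-elim (v↛K q′∈K (B⇒A q→q′))
  ... | inj₂ q∈K | inj₁ q′∈⁅v⁆ rewrite x∈⁅y⁆⇒x≡y v q′∈⁅v⁆ = ⊥-elim (K↛v q∈K q→q′)
  ... | inj₂ q∈K | inj₂ q′∈K = K-independent q∈K q′∈K q→q′

  insert-minimal : ∀ {K v} → HasMinimal A K → (∀ {x} → x ∈ K → ¬ A v x) → HasMinimal A (⁅ v ⁆ ∪ K)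
  insert-minimal {K} {v} K-minimal v↛K X (x , x∈X , x∈v∪K)
    with any? (λ y → (y ∈? X) ×-dec (y ∈? K))
  ... | yes X∩K-nonempty =
    let (q , q∈X , q∈K , q-minimal) = K-minimal X X∩K-nonempty
        minimal′ : ∀ {q′} → q′ ∈ X → q′ ∈ ⁅ v ⁆ ∪ K → A q′ q → q′ ≡ q
        minimal′ q′∈X q′∈v∪K q′→q = case x∈p∪q⁻ ⁅ v ⁆ K q′∈v∪K of λ
          { (inj₁ q′∈⁅v⁆) → ⊥-elim (v↛K q∈K (subst (λ y → A y q) (x∈⁅y⁆⇒x≡y v q′∈⁅v⁆) q′→q))
          ; (inj₂ q′∈K) → q-minimal q′∈X q′∈K q′→q }
    in q , q∈X , x∈p∪q⁺ (inj₂ q∈K) , minimal′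
  ... | no X∩K-empty =
    x , x∈X , x∈v∪K , λ q′∈X q′∈v∪K _ → trans (≡v q′∈X q′∈v∪K) (sym (≡v x∈X x∈v∪K))
    where
    ≡v : ∀ {y} → y ∈ X → y ∈ ⁅ v ⁆ ∪ K → y ≡ v
    ≡v y∈X y∈v∪K = case x∈p∪q⁻ ⁅ v ⁆ K y∈v∪K of λ
      { (inj₁ y∈⁅v⁆) → x∈⁅y⁆⇒x≡y v y∈⁅v⁆
      ; (inj₂ y∈K) → ⊥-elim (X∩K-empty (_ , y∈X , y∈K)) }

  nonSuccessor? : ∀ W v x → Dec (x ∈ W × ¬ A v x)
  nonSuccessor? W v x = (x ∈? W) ×-dec ¬? (A? v x)

  nonSuccessors : Subset n → Fin n → Subset n
  nonSuccessors W v = ⟦ nonSuccessor? W v ⟧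

  module _ {W v} (v∈W : v ∈ W) (K : QuasiKernel A B (nonSuccessors W v)) where

    kernel⊆nonSuccessors : ∀ {x} → x ∈ kernel K → x ∈ W × ¬ A v x
    kernel⊆nonSuccessors = ∈⟦⟧⁻ (nonSuccessor? W v) ∘ kernel⊆W K

    absorbing-or-successor : ∀ {w} → w ∈ W →
      A v w ⊎ ∃ λ q → q ∈ kernel K × ∃ λ x → B q x × A x w
    absorbing-or-successor {w} w∈W with A? v w
    ... | yes v→w = inj₁ v→w
    ... | no v↛w = inj₂ (absorbing K (∈⟦⟧⁺ (nonSuccessor? W v) (w∈W , v↛w)))

    keepKernel : ∀ {q} → q ∈ kernel K → B q v → QuasiKernel A B W
    keepKernel {q} q∈K q→v = record
      { kernel = kernel K
      ; kernel⊆W = proj₁ ∘ kernel⊆nonSuccessors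
      ; independent = independent K
      ; absorbing = λ w∈W → case absorbing-or-successor w∈W of λ
          { (inj₁ v→w) → q , q∈K , v , q→v , v→w
          ; (inj₂ absorbed) → absorbed }
      ; minimal = minimal K
      }

    insertVertex : (∀ {q} → q ∈ kernel K → ¬ B q v) → QuasiKernel A B W
    insertVertex K↛v = record
      { kernel = ⁅ v ⁆ ∪ kernel K
      ; kernel⊆W = λ x∈ → case x∈p∪q⁻ ⁅ v ⁆ (kernel K) x∈ of λ
          { (inj₁ x∈⁅v⁆) → ⁅x⁆⊆p v∈W x∈⁅v⁆
          ; (inj₂ x∈K) → proj₁ (kernel⊆nonSuccessors x∈K) }
      ; independent = insert-independent (independent K) (proj₂ ∘ kernel⊆nonSuccessors) K↛v
      ; absorbing = λ w∈W → case absorbing-or-successor w∈W of λ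
          { (inj₁ v→w) → v , x∈p∪q⁺ (inj₁ (x∈⁅x⁆ v)) , v , B-refl v , v→w
          ; (inj₂ (q , q∈K , absorbed)) → q , x∈p∪q⁺ (inj₂ q∈K) , absorbed }
      ; minimal = insert-minimal (minimal K) (proj₂ ∘ kernel⊆nonSuccessors)
      }

    addVertex : QuasiKernel A B W
    addVertex with any? (λ q → (q ∈? kernel K) ×-dec B? q v)
    ... | yes (q , q∈K , q→v) = keepKernel q∈K q→v
    ... | no none = insertVertex (λ q∈K q→v → none (_ , q∈K , q→v))

  quasiKernelFrom : (L : List (Fin n)) (W : Subset n) → (∀ {w} → w ∈ W → w ∈ₗ L) →
                    QuasiKernel A B W
  quasiKernelFrom [] W W⊆[] = record
    { kernel = ∅
    ; kernel⊆W = ⊥-elim ∘ ∉⊥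
    ; independent = λ q∈∅ _ _ → ⊥-elim (∉⊥ q∈∅)
    ; absorbing = λ w∈W → case W⊆[] w∈W of λ ()
    ; minimal = λ { _ (_ , _ , x∈∅) → ⊥-elim (∉⊥ x∈∅) }
    }
  quasiKernelFrom (v ∷ L) W W⊆v∷L with v ∈? W
  ... | no v∉W = quasiKernelFrom L W W⊆L
    where
    W⊆L : ∀ {w} → w ∈ W → w ∈ₗ L
    W⊆L w∈W with W⊆v∷L w∈W
    ... | here refl = ⊥-elim (v∉W w∈W)
    ... | there w∈L = w∈L
  ... | yes v∈W = addVertex v∈W (quasiKernelFrom L (nonSuccessors W v) nonSuccessors⊆L)
    where
    nonSuccessors⊆L : ∀ {w} → w ∈ nonSuccessors W v → w ∈ₗ L
    nonSuccessors⊆L w∈ with ∈⟦⟧⁻ (nonSuccessor? W v) w∈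
    ... | w∈W , v↛w with W⊆v∷L w∈W
    ...   | here refl = ⊥-elim (v↛w (B⇒A (B-refl v)))
    ...   | there w∈L = w∈L

  quasiKernel : (W : Subset n) → QuasiKernel A B W
  quasiKernel W = quasiKernelFrom (allFin n) W (λ {w} _ → ∈-allFin w)

module _ {D : Digraph n} {U : Subset n} where
  open QuasiKernel

  walkQuasiKernel : ∀ {s t} → s ≤ t → (W : Subset n) →
                    QuasiKernel (WalkIn D U t) (WalkIn D U s) W
  walkQuasiKernel s≤t =
    QuasiKernelConstruction.quasiKernel (walk? _) (walk? _) (λ _ → nil) (weaken-walk s≤t)

  kernel-independent : ∀ {s t W} (K : QuasiKernel (WalkIn D U t) (WalkIn D U (suc s)) W) →
                       W ⊆ U → Independent D (kernel K)
  kernel-independent K W⊆U u v u∈K v∈K u→v =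
    arc⇒≢ D u→v (independent K u∈K v∈K (cons (W⊆U (kernel⊆W K u∈K)) u→v nil))

  kernel-dominates : ∀ {s t W} (K : QuasiKernel (WalkIn D U t) (WalkIn D U s) W) →
                     Dominates D U (s + t) (kernel K) W
  kernel-dominates K w∈W =
    let (q , q∈K , x , q⇝x , x⇝w) = absorbing K w∈W in q , q∈K , q⇝x ++ʷ x⇝w

record KernelIn (D : Digraph n) (U W : Subset n) (β : Fin r → ℕ) : Set where
  field
    layer       : Fin r → Subset n
    layer⊆W     : ∀ i → layer i ⊆ W
    disjoint    : ∀ i j → i ≢ j → ∀ v → v ∈ layer i → v ∉ layer j
    independent : ∀ i → Independent D (layer i)
    dominates   : ∀ i → Dominates D U (β i) (layer i) W

singleLayer : ∀ {D : Digraph n} {U W Q d} →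
              Q ⊆ W → Independent D Q → Dominates D U d Q W → KernelIn D U W (λ (_ : Fin 1) → d)
singleLayer {Q = Q} Q⊆W Q-independent Q-dominates = record
  { layer = λ _ → Q
  ; layer⊆W = λ _ → Q⊆W
  ; disjoint = λ { zero zero 0≢0 → ⊥-elim (0≢0 refl) }
  ; independent = λ _ → Q-independent
  ; dominates = λ _ → Q-dominates
  }

-- A vertex of Q₀ is reached through an in-neighbour outside Q₀.
extend : ∀ {D : Digraph n} {U Q₀ c b} {γ : Fin r → ℕ} {β : Vec ℕ r} →
  (∀ {v} → v ∈ U → ∃ λ u → u ∈ U × Arc D u v) →
  Q₀ ⊆ U → Independent D Q₀ → Dominates D U c Q₀ U →
  KernelIn D U (U ─ Q₀) γ → (∀ j → suc (γ j) ≤ lookup β j) → c ≤ b →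
  KernelIn D U U (lookup (β ∷ʳ b))
extend {n} {r} {D} {U} {Q₀} {c} {b} {γ} {β}
       inNeighbour′ Q₀⊆U Q₀-independent Q₀-dominates K γ<β c≤b = record
  { layer = layer
  ; layer⊆W = layer⊆U
  ; disjoint = disjoint
  ; independent = independent
  ; dominates = dominates
  }
  where
  module K = KernelIn K

  layer : Fin (suc r) → Subset n
  layer = lookup (tabulate K.layer ∷ʳ Q₀)

  layer-inject : ∀ j → layer (inject₁ j) ≡ K.layer j
  layer-inject j = trans (lookup-∷ʳ-inject₁ (tabulate K.layer) Q₀ j) (lookup∘tabulate K.layer j)

  layer-last : layer (fromℕ r) ≡ Q₀
  layer-last = lookup-∷ʳ-last (tabulate K.layer) Q₀

  ∉Q₀ : ∀ j {v} → v ∈ K.layer j → v ∉ Q₀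
  ∉Q₀ j v∈ = x∈p─q⇒x∉q U Q₀ (K.layer⊆W j v∈)

  layer⊆U : ∀ i → layer i ⊆ U
  layer⊆U i with injectOrLast i
  ... | inject j rewrite layer-inject j = p─q⊆p U Q₀ ∘ K.layer⊆W j
  ... | last rewrite layer-last = Q₀⊆U

  disjoint : ∀ i i′ → i ≢ i′ → ∀ v → v ∈ layer i → v ∉ layer i′
  disjoint i i′ i≢i′ v with injectOrLast i | injectOrLast i′
  ... | inject j | inject j′ rewrite layer-inject j | layer-inject j′ =
    K.disjoint j j′ (i≢i′ ∘ cong inject₁) v
  ... | inject j | last rewrite layer-inject j | layer-last = ∉Q₀ j
  ... | last | inject j′ rewrite layer-last | layer-inject j′ = λ v∈Q₀ v∈ → ∉Q₀ j′ v∈ v∈Q₀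
  ... | last | last = ⊥-elim (i≢i′ refl)

  independent : ∀ i → Independent D (layer i)
  independent i with injectOrLast i
  ... | inject j rewrite layer-inject j = K.independent j
  ... | last rewrite layer-last = Q₀-independent

  dominates-U : ∀ j → Dominates D U (lookup β j) (K.layer j) U
  dominates-U j {v} v∈U with v ∈? Q₀
  ... | no v∉Q₀ =
    weaken-dominates (≤-trans (n≤1+n _) (γ<β j)) (K.dominates j) (x∈p∧x∉q⇒x∈p─q v∈U v∉Q₀)
  ... | yes v∈Q₀ =
    let (u , u∈U , u→v) = inNeighbour′ v∈U
        u∉Q₀ = λ u∈Q₀ → Q₀-independent _ _ u∈Q₀ v∈Q₀ u→v
        (q , q∈ , q⇝u) = K.dominates j (x∈p∧x∉q⇒x∈p─q u∈U u∉Q₀)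
    in q , q∈ , weaken-walk (γ<β j) (q⇝u ∷ʳʷ (u∈U , u→v))

  dominates : ∀ i → Dominates D U (lookup (β ∷ʳ b) i) (layer i) U
  dominates i with injectOrLast i
  ... | inject j rewrite layer-inject j | lookup-∷ʳ-inject₁ β b j = dominates-U j
  ... | last rewrite layer-last | lookup-∷ʳ-last β b = weaken-dominates c≤b Q₀-dominates

-- The square of a digraph through a vertex set

SquareArc : Digraph n → Subset n → Fin n → Fin n → Set
SquareArc D U u v = u ≢ v × (Arc D u v ⊎ ∃ λ w → w ∈ U × Arc D u w × Arc D w v)

squareArc? : (D : Digraph n) (U : Subset n) → ∀ u v → Dec (SquareArc D U u v)
squareArc? D U u v =
  ¬? (u ≟ v) ×-dec (arc? D u v ⊎-dec any? (λ w → (w ∈? U) ×-dec arc? D u w ×-dec arc? D w v))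

square : Digraph n → Subset n → Digraph n
square D U = record
  { arc = λ u v → does (squareArc? D U u v)
  ; noLoops = λ v → dec-false (squareArc? D U v v) (λ (v≢v , _) → v≢v refl)
  }

module _ {D : Digraph n} {U : Subset n} where

  square-arc⁺ : ∀ {u v} → SquareArc D U u v → Arc (square D U) u v
  square-arc⁺ {u} {v} = dec-true (squareArc? D U u v)

  square-arc⁻ : ∀ {u v} → Arc (square D U) u v → SquareArc D U u v
  square-arc⁻ {u} {v} = does-true (squareArc? D U u v)

  square-independent⇒independent : ∀ {Q} → Independent (square D U) Q → Independent D Q
  square-independent⇒independent Q-independent u v u∈Q v∈Q u→v =
    Q-independent u v u∈Q v∈Q (square-arc⁺ (arc⇒≢ D u→v , inj₁ u→v))

  square-walk⇒walk : ∀ {W m u v} → W ⊆ U → WalkIn (square D U) W m u v → WalkIn D U (2 * m) u v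
  square-walk⇒walk W⊆U nil = nil
  square-walk⇒walk {m = suc m} W⊆U (cons u∈W u⇒w w⇝v) rewrite *-suc 2 m
    with proj₂ (square-arc⁻ u⇒w)
  ... | inj₁ u→w = cons (W⊆U u∈W) u→w (weaken-walk (n≤1+n _) (square-walk⇒walk W⊆U w⇝v))
  ... | inj₂ (x , x∈U , u→x , x→w) =
    cons (W⊆U u∈W) u→x (cons x∈U x→w (square-walk⇒walk W⊆U w⇝v))

  fromSquare : ∀ {W} {β : Fin r → ℕ} →
               W ⊆ U → KernelIn (square D U) W W β → KernelIn D U W (λ i → 2 * β i)
  fromSquare W⊆U K = record
    { layer = K.layer
    ; layer⊆W = K.layer⊆W
    ; disjoint = K.disjoint
    ; independent = square-independent⇒independent ∘ K.independent
    ; dominates = λ i v∈W →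
        let (q , q∈ , q⇝v) = K.dominates i v∈W in q , q∈ , square-walk⇒walk W⊆U q⇝v
    }
    where module K = KernelIn K

-- Let S be a small source set of the square inside U ─ Q₀, and K the set of the
-- vertices of S and of those of Q₀ with an arc into S. If K misses Q₀ then S is already a source set of D; otherwise a minimal q ∈ K ∩ Q₀
-- has its whole ball of radius t + 1 inside S ∪ {q}, while that ball has over t + 1 vertices.
module _ {D : Digraph n} {U Q₀ : Subset n} {t : ℕ}
  (Q₀⊆U : Q₀ ⊆ U) (Q₀-independent : Independent D Q₀)
  (Q₀-minimal : HasMinimal (WalkIn D U (suc t)) Q₀) (noSource : NoSSourceSetIn D U (suc t)) where

  module _ {S : Subset n} (S⊆ : S ⊆ U ─ Q₀)
           (S-source : IsSourceSetIn (square D U) (U ─ Q₀) S) where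

    InK : Fin n → Set
    InK x = x ∈ S ⊎ (x ∈ Q₀ × ∃ λ y → y ∈ S × Arc D x y)

    inK? : ∀ x → Dec (InK x)
    inK? x = (x ∈? S) ⊎-dec ((x ∈? Q₀) ×-dec any? (λ y → (y ∈? S) ×-dec arc? D x y))

    K : Subset n
    K = ⟦ inK? ⟧

    no-square-arc-into-S : ∀ {u v} → u ∈ U → u ∉ Q₀ → u ∉ S → v ∈ S →
                           ¬ (Arc D u v ⊎ ∃ λ w → w ∈ U × Arc D u w × Arc D w v)
    no-square-arc-into-S {u} {v} u∈U u∉Q₀ u∉S v∈S path =
      S-source u v v∈S (x∈p∧x∉q⇒x∈p─q u∈U u∉Q₀) u∉S
               (square-arc⁺ {D = D} ((λ { refl → u∉S v∈S }) , path))

    K-closed : ∀ {u a} → u ∈ U → Arc D u a → InK a → InK u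
    K-closed {u} u∈U u→a a∈K with u ∈? S | u ∈? Q₀ | a∈K
    ... | yes u∈S | _ | _ = inj₁ u∈S
    ... | no _ | yes u∈Q₀ | inj₁ a∈S = inj₂ (u∈Q₀ , _ , a∈S , u→a)
    ... | no _ | yes u∈Q₀ | inj₂ (a∈Q₀ , _) = ⊥-elim (Q₀-independent _ _ u∈Q₀ a∈Q₀ u→a)
    ... | no u∉S | no u∉Q₀ | inj₁ a∈S =
      ⊥-elim (no-square-arc-into-S u∈U u∉Q₀ u∉S a∈S (inj₁ u→a))
    ... | no u∉S | no u∉Q₀ | inj₂ (a∈Q₀ , v , v∈S , a→v) =
      ⊥-elim (no-square-arc-into-S u∈U u∉Q₀ u∉S v∈S (inj₂ (_ , Q₀⊆U a∈Q₀ , u→a , a→v)))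

    K-closed-walk : ∀ {m u a} → WalkIn D U m u a → InK a → InK u
    K-closed-walk nil = id
    K-closed-walk (cons u∈U u→w w⇝a) = K-closed u∈U u→w ∘ K-closed-walk w⇝a

    source-in-D : (∀ {x} → x ∈ K → x ∉ Q₀) → IsSourceSetIn D U S
    source-in-D K∩Q₀-empty u v v∈S u∈U u∉S u→v with K-closed u∈U u→v (inj₁ v∈S)
    ... | inj₁ u∈S = u∉S u∈S
    ... | inj₂ (u∈Q₀ , u→S) = K∩Q₀-empty (∈⟦⟧⁺ inK? (inj₂ (u∈Q₀ , u→S))) u∈Q₀

    ball⊆S∪⁅q⁆ : ∀ {q} → q ∈ K →
                 (∀ {q′} → q′ ∈ K → q′ ∈ Q₀ → WalkIn D U (suc t) q′ q → q′ ≡ q) →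
                 ball {D = D} {U} (suc t) q ⊆ S ∪ ⁅ q ⁆
    ball⊆S∪⁅q⁆ {q} q∈K q-minimal {y} y∈ball with ∈⟦⟧⁻ (inBall? (suc t) q) y∈ball
    ... | (_ , y⇝q) with K-closed-walk y⇝q (∈⟦⟧⁻ inK? q∈K)
    ...   | inj₁ y∈S = x∈p∪q⁺ (inj₁ y∈S)
    ...   | inj₂ y∈Q₀∩K@(y∈Q₀ , _) =
      let y≡q = q-minimal (∈⟦⟧⁺ inK? (inj₂ y∈Q₀∩K)) y∈Q₀ y⇝q in
      x∈p∪q⁺ (inj₂ (subst (_∈ ⁅ q ⁆) (sym y≡q) (x∈⁅x⁆ q)))

    small-square-source-absurd : Nonempty S → ∣ S ∣ ≤ t → ⊥
    small-square-source-absurd S-nonempty ∣S∣≤t with any? (λ x → (x ∈? K) ×-dec (x ∈? Q₀))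
    ... | no K∩Q₀-empty =
      noSource (p─q⊆p U Q₀ ∘ S⊆) (source-in-D (λ x∈K x∈Q₀ → K∩Q₀-empty (_ , x∈K , x∈Q₀)))
               S-nonempty (≤-trans ∣S∣≤t (n≤1+n t))
    ... | yes K∩Q₀-nonempty =
      let (q , q∈K , q∈Q₀ , q-minimal) = Q₀-minimal K K∩Q₀-nonempty
          open ≤-Reasoning
      in <-irrefl refl (begin-strict
        suc t                 <⟨ radius<∣ball∣ noSource (Q₀⊆U q∈Q₀) (suc t) ≤-refl ⟩
        ∣ ball (suc t) q ∣    ≤⟨ p⊆q⇒∣p∣≤∣q∣ (ball⊆S∪⁅q⁆ q∈K q-minimal) ⟩
        ∣ S ∪ ⁅ q ⁆ ∣         ≤⟨ ∣p∪⁅x⁆∣≤1+∣p∣ S q ⟩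
        suc ∣ S ∣             ≤⟨ s≤s ∣S∣≤t ⟩
        suc t                 ∎)

  square-noSSourceSetIn : NoSSourceSetIn (square D U) (U ─ Q₀) t
  square-noSSourceSetIn S⊆ S-source = small-square-source-absurd S⊆ S-source

1+2b≤2[b+1+k] : ∀ b k → suc (2 * b) ≤ 2 * (b + suc k)
1+2b≤2[b+1+k] b k = subst (suc (2 * b) ≤_) 2[b+1+k]≡ (m≤m+n (suc (2 * b)) (suc (2 * k)))
  where
  open +-*-Solver
  2[b+1+k]≡ : suc (2 * b) + suc (2 * k) ≡ 2 * (b + suc k)
  2[b+1+k]≡ = solve 2 (λ b k → (con 1 :+ con 2 :* b) :+ (con 1 :+ con 2 :* k)
                              := con 2 :* (b :+ (con 1 :+ k))) refl b k

[1+k]+[2+k]≡2k+3 : ∀ k → suc k + suc (suc k) ≡ 2 * k + 3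
[1+k]+[2+k]≡2k+3 = solve 1 (λ k → (con 1 :+ k) :+ (con 2 :+ k) := con 2 :* k :+ con 3) refl
  where open +-*-Solver

module _ {D : Digraph n} {U : Subset n} where

  betaKernel₂In : NoSSourceSetIn D U 1 → KernelIn D U U (lookup (betaVec 0))
  betaKernel₂In noSource =
    extend {β = 3 ∷ []} (inNeighbour {D = D} noSource)
           K₂.kernel⊆W (kernel-independent K₂ id) (kernel-dominates K₂)
           (singleLayer K₁.kernel⊆W (kernel-independent K₁ (p─q⊆p U K₂.kernel))
                        (kernel-dominates K₁))
           (λ { zero → ≤-refl }) ≤-refl
    where
    K₂ = walkQuasiKernel {D = D} {U} {1} {1} ≤-refl U
    module K₂ = QuasiKernel K₂
    K₁ = walkQuasiKernel {D = D} {U} {1} {1} ≤-refl (U ─ K₂.kernel)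
    module K₁ = QuasiKernel K₁

betaKernelIn : ∀ k {n} {D : Digraph n} {U} →
               NoSSourceSetIn D U (suc k) → KernelIn D U U (lookup (betaVec k))
betaKernelIn zero = betaKernel₂In
betaKernelIn (suc k) {D = D} {U} noSource =
  extend {β = map f (betaVec k)} (inNeighbour {D = D} noSource)
         K₀.kernel⊆W Q₀-independent (kernel-dominates K₀)
         (fromSquare (p─q⊆p U K₀.kernel) (betaKernelIn k square-noSource))
         layer-bound (≤-reflexive ([1+k]+[2+k]≡2k+3 k))
  where
  f : ℕ → ℕ
  f b = 2 * (b + suc k)
  K₀ = walkQuasiKernel {D = D} {U} {suc k} {suc (suc k)} (n≤1+n _) U
  module K₀ = QuasiKernel K₀
  Q₀-independent = kernel-independent K₀ id
  square-noSource = square-noSSourceSetIn K₀.kernel⊆W Q₀-independent K₀.minimal noSource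
  layer-bound : ∀ j → suc (2 * lookup (betaVec k) j) ≤ lookup (map f (betaVec k)) j
  layer-bound j rewrite lookup-map j f (betaVec k) = 1+2b≤2[b+1+k] (lookup (betaVec k) j) k

theorem5p2 : (k n : ℕ) (D : Digraph n) →
    ¬ (Σ (Subset n) λ S → IsSSourceSet D (suc k) S) →
    Σ (Fin (suc (suc k)) → Subset n) λ Q → IsBetaKernel D (betaVec k) Q
theorem5p2 k n D noSource = layer , disjoint , λ i → independent i , dist≤β i
  where
  noSourceIn : NoSSourceSetIn D ⊤ (suc k)
  noSourceIn {S} _ S-source S-nonempty ∣S∣≤ =
    noSource (S , (λ u v v∈S u∉S → S-source u v v∈S ∈⊤ u∉S) , S-nonempty , ∣S∣≤)
  open KernelIn (betaKernelIn k noSourceIn)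
  dist≤β : ∀ i v → DistLe D (layer i) v (lookup (betaVec k) i)
  dist≤β i v = let (q , q∈ , q⇝v) = dominates i ∈⊤ in q , q∈ , WalkIn⇒Walk q⇝v
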